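{- Let $\mathbb{I}$ be an interval. Every based Segal complete type is Segal complete.
   Context: Homotopy type theory. An interval is a set $\mathbb{I}$ with bounded meet-semilattice structure $(0,1,\sqcap)$, $i\sqsubseteq j$ meaning $i\sqcap j=i$; $[\![i]\!]:\equiv(i=1)$. For $f\colon A\to B$, $X$ is $f$-local if $X^f\colon X^B\to X^A$, $g\mapsto g\circ f$, is an equivalence. $\Delta^2:\equiv\{(j,i)\mid j\sqsupseteq i\}$, written $(j\sqsupseteq i)$; the horn is $\Lambda:\equiv\{(j\sqsupseteq i)\in\Delta^2\mid i=0\lor j=1\}$; $X$ is Segal complete if it is local for $\Lambda\hookrightarrow\Delta^2$. $\mathbb{I}/j:\equiv\{i\mid i\sqsubseteq j\}$. The join $P*X$ is the pushout of $P\leftarrow P\times X\to X$; the Sierpiński cone of $X$ is $X_\bot:\equiv\sum_{i:\mathbb{I}}(i=0)*X$; $[\![j]\!]_\bot$ is the Sierpiński cone of the proposition $[\![j]\!]$, $\simeq\{i\mid i=0\lor j=1\}$, included in $\mathbb{I}/j$ by $i\mapsto i$. $X$ is based Segal complete if for every $j:\mathbb{I}$ it is local for $[\![j]\!]_\bot\hookrightarrow\mathbb{I}/j$ (equivalently, $\mathbb{I}\times X$ is local for $\Lambda\hookrightarrow\Delta^2$ in the slice over $\mathbb{I}$, where both are displayed over $\mathbb{I}$ by $(j\sqsupseteq i)\mapsto j$). -}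

{-# OPTIONS --without-K #-}
module Defs where

open import Level using (Level; _⊔_; suc; Setω)
open import Data.Product using (Σ; Σ-syntax; _×_; _,_; proj₁; proj₂)
open import Data.Sum using (_⊎_; inj₁; inj₂)
open import Relation.Binary.PropositionalEquality using (_≡_; refl; sym; trans; cong)
open import Function using (_∘_)
open import Axiom.Extensionality.Propositional using (Extensionality)

isContr : ∀ {a} → Set a → Set a
isContr A = Σ[ x ∈ A ] (∀ y → x ≡ y)

isProp : ∀ {a} → Set a → Set a
isProp A = (x y : A) → x ≡ y

isSet : ∀ {a} → Set a → Set a
isSet A = (x y : A) → isProp (x ≡ y)

fiber : ∀ {a b} {A : Set a} {B : Set b} → (A → B) → B → Set (a ⊔ b)
fiber {A = A} f y = Σ[ x ∈ A ] (f x ≡ y)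

isEquiv : ∀ {a b} {A : Set a} {B : Set b} → (A → B) → Set (a ⊔ b)
isEquiv {B = B} f = (y : B) → isContr (fiber f y)

FunExt : Setω
FunExt = ∀ {a b} → Extensionality a b

-- Propositional truncation, given as an interface (no HITs in plain Agda):
-- a type former with constructor, propositionality, and recursion into props.
record PropTrunc : Setω where
  field
    ∥_∥    : ∀ {a} → Set a → Set a
    ∣_∣    : ∀ {a} {A : Set a} → A → ∥ A ∥
    squash : ∀ {a} {A : Set a} → isProp ∥ A ∥
    rec    : ∀ {a b} {A : Set a} {P : Set b} → isProp P → (A → P) → ∥ A ∥ → P

isLocal : ∀ {a b x} {A : Set a} {B : Set b} → (A → B) → Set x → Set (a ⊔ b ⊔ x)
isLocal {A = A} {B = B} f X = isEquiv (λ (g : B → X) → g ∘ f)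

record Interval (ℓ : Level) : Set (suc ℓ) where
  field
    𝕀       : Set ℓ
    𝕀-isSet : isSet 𝕀
    𝟎 𝟏     : 𝕀
    _⊓_     : 𝕀 → 𝕀 → 𝕀
    ⊓-assoc : ∀ i j k → (i ⊓ j) ⊓ k ≡ i ⊓ (j ⊓ k)
    ⊓-comm  : ∀ i j → i ⊓ j ≡ j ⊓ i
    ⊓-idem  : ∀ i → i ⊓ i ≡ i
    ⊓-unit  : ∀ i → i ⊓ 𝟏 ≡ i
    ⊓-zero  : ∀ i → 𝟎 ⊓ i ≡ 𝟎

  _⊑_ : 𝕀 → 𝕀 → Set ℓ
  i ⊑ j = i ⊓ j ≡ i

module Shapes {ℓ : Level} (I : Interval ℓ) (T : PropTrunc) where
  open Interval I
  open PropTrunc T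

  Δ² : Set ℓ
  Δ² = Σ[ p ∈ 𝕀 × 𝕀 ] (proj₂ p ⊑ proj₁ p)

  Λ : Set ℓ
  Λ = Σ[ t ∈ Δ² ] ∥ (proj₂ (proj₁ t) ≡ 𝟎) ⊎ (proj₁ (proj₁ t) ≡ 𝟏) ∥

  Λ↪Δ² : Λ → Δ²
  Λ↪Δ² = proj₁

  𝕀/ : 𝕀 → Set ℓ
  𝕀/ j = Σ[ i ∈ 𝕀 ] (i ⊑ j)

  -- [[j]]⊥ ≃ {i | i = 0 ∨ j = 1}  (Sierpiński cone of the proposition j = 1)
  ⟦_⟧⊥ : 𝕀 → Set ℓ
  ⟦ j ⟧⊥ = Σ[ i ∈ 𝕀 ] ∥ (i ≡ 𝟎) ⊎ (j ≡ 𝟏) ∥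

  private
    below : ∀ i j → (i ≡ 𝟎) ⊎ (j ≡ 𝟏) → i ⊑ j
    below i j (inj₁ refl) = ⊓-zero j
    below i j (inj₂ refl) = ⊓-unit i

  ⟦_⟧⊥↪ : (j : 𝕀) → ⟦ j ⟧⊥ → 𝕀/ j
  ⟦ j ⟧⊥↪ (i , h) = i , rec (𝕀-isSet (i ⊓ j) i) (below i j) h

  SegalComplete : ∀ {x} → Set x → Set (ℓ ⊔ x)
  SegalComplete X = isLocal Λ↪Δ² X

  BasedSegalComplete : ∀ {x} → Set x → Set (ℓ ⊔ x)
  BasedSegalComplete X = (j : 𝕀) → isLocal ⟦ j ⟧⊥↪ X

{-# OPTIONS --safe #-}
{-# OPTIONS --without-K #-}

-- Fibring Δ² and Λ over the top vertex j identifies Λ ↪ Δ² with the total map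
-- of the family [[j]]⊥ ↪ 𝕀/j.  A map out of a Σ-type is a family of maps out
-- of its fibres, so locality for every fibre map gives locality for the total
-- map, and locality is invariant under isomorphism of arrows.

module Submission where

open import Defs
open import Level using (Level)
open import Data.Product using (Σ; _,_; proj₁; proj₂; map₂; curry)
open import Function using (_∘_; _$_)
open import Function.Bundles using (_↔_; Inverse; mk↔ₛ′)
open import Function.Properties.Inverse using (↔-refl; ↔-sym; ↔-trans; ↔-fun)
open import Function.Properties.Inverse.HalfAdjointEquivalence using (_≃_; ↔⇒≃)
open import Function.Related.TypeIsomorphisms using (Σ-assoc)
open import Relation.Binary.PropositionalEquality
  using (_≡_; refl; sym; trans; cong; _≗_; module ≡-Reasoning)

open Inverse using (to; from; strictlyInverseˡ; strictlyInverseʳ)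

private
  variable
    a b : Level
    A A′ B B′ J X : Set a

fiber-≡ : (f : A → B) {y z : A} (q : y ≡ z) (r : f y ≡ f z) →
          cong f q ≡ r → _≡_ {A = fiber f (f z)} (y , r) (z , refl)
fiber-≡ f refl .refl refl = refl

-- The coherence of a half-adjoint equivalence is what makes the fibres contractible.
↔⇒isEquiv : (e : A ↔ B) → isEquiv (to e)
↔⇒isEquiv e y = (from e y , right-inverse-of y) , contraction y
  where
  open _≃_ (↔⇒≃ e) using (left-inverse-of; right-inverse-of; left-right)
  contraction : ∀ y (p : fiber (to e) y) → (from e y , right-inverse-of y) ≡ p
  contraction .(to e z) (z , refl) =
    fiber-≡ (to e) (left-inverse-of z) (right-inverse-of (to e z)) (left-right z)

isEquiv⇒↔ : {f : A → B} → isEquiv f → A ↔ B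
isEquiv⇒↔ {f = f} equiv = mk↔ₛ′ f
  (λ y → proj₁ (proj₁ (equiv y)))
  (λ y → proj₂ (proj₁ (equiv y)))
  (λ z → cong proj₁ (proj₂ (equiv (f z)) (z , refl)))

isEquiv-resp-≗ : {f g : A → B} → f ≗ g → isEquiv f → isEquiv g
isEquiv-resp-≗ {f = f} {g} f≗g equiv = ↔⇒isEquiv $ mk↔ₛ′ g (from e)
  (λ y → trans (sym (f≗g (from e y))) (strictlyInverseˡ e y))
  (λ z → trans (cong (from e) (sym (f≗g z))) (strictlyInverseʳ e z))
  where e = isEquiv⇒↔ equiv

isLocal-map₂ : FunExt → {A : J → Set a} {B : J → Set b} {f : ∀ {j} → A j → B j} →
               (∀ j → isLocal (f {j}) X) → isLocal (map₂ f) X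
isLocal-map₂ {J = J} {X = X} fe {A = A} {B} {f} local = ↔⇒isEquiv $ mk↔ₛ′ (_∘ map₂ f) extend
  (λ h → fe λ (j , a) → cong (_$ a) (strictlyInverseˡ (fibre j) (curry h j)))
  (λ g → fe λ (j , b) → cong (_$ b) (strictlyInverseʳ (fibre j) (curry g j)))
  where
  fibre : ∀ j → (B j → X) ↔ (A j → X)
  fibre j = isEquiv⇒↔ (local j)
  extend : (Σ J A → X) → (Σ J B → X)
  extend h (j , b) = from (fibre j) (curry h j) b

isLocal-resp-↔ : FunExt → {f : A → B} {f′ : A′ → B′} (α : A′ ↔ A) (β : B′ ↔ B) →
                 (∀ z → to β (f′ z) ≡ f (to α z)) → isLocal f X → isLocal f′ X
isLocal-resp-↔ fe {f = f} {f′} α β square local =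
  isEquiv-resp-≗ (λ g → fe (cong g ∘ along))
    (↔⇒isEquiv (↔-trans (↔-trans (↔-fun fe β ↔-refl) (isEquiv⇒↔ local))
                        (↔-fun fe (↔-sym α) ↔-refl)))
  where
  along : ∀ z → from β (f (to α z)) ≡ f′ z
  along z = begin
    from β (f (to α z))  ≡⟨ cong (from β) (sym (square z)) ⟩
    from β (to β (f′ z)) ≡⟨ strictlyInverseʳ β (f′ z) ⟩
    f′ z                 ∎
    where open ≡-Reasoning

module _ {ℓ : Level} (I : Interval ℓ) (T : PropTrunc) where
  open Interval I
  open PropTrunc T
  open Shapes I T

  ⊑-isProp : ∀ {i j} → isProp (i ⊑ j)
  ⊑-isProp = 𝕀-isSet _ _

  Δ²↔Σ𝕀/ : Δ² ↔ Σ 𝕀 𝕀/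
  Δ²↔Σ𝕀/ = Σ-assoc

  Λ↔Σ⟦⟧⊥ : Λ ↔ Σ 𝕀 ⟦_⟧⊥
  Λ↔Σ⟦⟧⊥ = mk↔ₛ′
    (λ (((j , i) , _) , t) → j , i , t)
    (λ (j , i , t) → ((j , i) , proj₂ (⟦ j ⟧⊥↪ (i , t))) , t)
    (λ _ → refl)
    (λ (((j , i) , _) , t) → cong (λ p → ((j , i) , p) , t) (⊑-isProp _ _))

  Λ↪Δ²-fibred : ∀ l → to Δ²↔Σ𝕀/ (Λ↪Δ² l) ≡ map₂ (⟦ _ ⟧⊥↪) (to Λ↔Σ⟦⟧⊥ l)
  Λ↪Δ²-fibred (((j , i) , _) , _) = cong (λ p → j , i , p) (⊑-isProp _ _)

mainTheorem20 : FunExt → {ℓ x : Level} (I : Interval ℓ) (T : PropTrunc) (X : Set x) →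
    Shapes.BasedSegalComplete I T X → Shapes.SegalComplete I T X
mainTheorem20 fe I T X based =
  isLocal-resp-↔ fe (Λ↔Σ⟦⟧⊥ I T) (Δ²↔Σ𝕀/ I T) (Λ↪Δ²-fibred I T) (isLocal-map₂ fe based)
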